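{- Let $n,m,r,s$ be positive integers with $m>r$ and $n>r$, and let $\lambda=(n^m,r^s)$. If $n=r+1$, or $n=r+2$, or ($n>r+2$ and $n-r$ is even), then $\mathrm{SG}(\lambda)=0$ if $r+m$ is even and $\mathrm{SG}(\lambda)=1$ if $r+m$ is odd. If $n>r+2$ and $n-r$ is odd, then $\mathrm{SG}(\lambda)=0$ if $m-r$ is odd and $m-r\ge 3$; $\mathrm{SG}(\lambda)=1$ if $m-r=1$ or if $m-r$ is even and $m-r\ge 4$; and $\mathrm{SG}(\lambda)=2$ if $m-r=2$.
   Context: A partition is a finite weakly decreasing sequence of positive integers; $(a^k)$ denotes $k$ parts equal to $a$, so $(n^m,r^s)$ has $m$ parts equal to $n$ followed by $s$ parts equal to $r$. LCTR is the impartial game on partitions where from a nonempty $\lambda=(\lambda_1,\dots,\lambda_k)$ one may move to $T(\lambda)=(\lambda_2,\dots,\lambda_k)$ or to $L(\lambda)=(\lambda_1-1,\dots,\lambda_k-1)$ (nonpositive entries omitted); the empty partition has no moves. $\mathrm{SG}(())=0$ and $\mathrm{SG}(\lambda)=\mathrm{mex}\{\mathrm{SG}(L(\lambda)),\mathrm{SG}(T(\lambda))\}$ otherwise, $\mathrm{mex}(B)$ being the least nonnegative integer not in $B$. -}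

module Defs where

open import Data.Nat using (ℕ; zero; suc; _∸_; _+_; _≟_)
open import Data.List using (List; []; _∷_; replicate; _++_)
open import Data.Nat.ListAction using (sum)
open import Data.Nat.Divisibility using (_∣_)
open import Relation.Nullary using (¬_)
open import Relation.Nullary using (yes; no)

-- A partition is represented as a list of positive naturals (weakly decreasing).
Partition : Set
Partition = List ℕ

_^^_ : ℕ → ℕ → Partition
a ^^ k = replicate k a

T : Partition → Partition
T []       = []
T (_ ∷ xs) = xs

L : Partition → Partition
L []             = []
L (zero ∷ xs)    = L xs
L (suc x ∷ xs)   = dropZero x (L xs)
  where
  dropZero : ℕ → Partition → Partition
  dropZero zero    ys = ys
  dropZero (suc y) ys = suc y ∷ ys

mex2 : ℕ → ℕ → ℕ
mex2 zero zero = suc zero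
mex2 zero (suc zero) = suc (suc zero)
mex2 zero (suc (suc _)) = suc zero
mex2 (suc zero) zero = suc (suc zero)
mex2 (suc (suc _)) zero = suc zero
mex2 (suc _) (suc _) = zero

-- For a partition with positive
-- entries, every move (L or T) strictly decreases the sum of parts, so fuel
-- equal to  sum λ + 1  is always sufficient (the fuel never runs out before
-- reaching the empty partition).
sgFuel : ℕ → Partition → ℕ
sgFuel _        []          = zero
sgFuel zero     (_ ∷ _)     = zero
sgFuel (suc f)  (x ∷ xs)    = mex2 (sgFuel f (L (x ∷ xs))) (sgFuel f (T (x ∷ xs)))

SG : Partition → ℕ
SG λ′ = sgFuel (suc (sum λ′)) λ′

Even : ℕ → Set
Even k = 2 ∣ k

Odd : ℕ → Set
Odd k = ¬ (2 ∣ k)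

-- SG obeys its recursion SG λ = mex (SG (L λ), SG (T λ)) once the fuel exceeds the sum
-- of the parts. Along a column of positions this reads f (k+1) = mex (g k, f k), where g is
-- the neighbouring column, and if g is eventually 2-periodic then so is f, after checking
-- one period. For rectangles (c^p) this yields, by induction on c, the columns
-- 1,2,1,2,… (c = 1), 2,0,2,0,… (c = 2), 1,2,0,1,0,1,… (c ≥ 3 odd) and 2,0,1,0,1,0,…
-- (c ≥ 4 even). For (n^m, r^s) with c = n − r fixed, L lowers n and r together, so the
-- values at m = r + k form columns indexed by r. For r = 1 the move L erases the r-block
-- and the neighbouring column is the rectangle (c^m); moving up in r then preserves the
-- pattern, which is 1,0,1,0,… for k ≥ 1 unless c is odd and at least 3, where it is
-- 0,1,2,0,1,0,1,….
module Submission where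

open import Defs
open import Data.Nat using (ℕ; zero; suc; _+_; _*_; _∸_; _<_; _>_; _≤_; _≥_; z≤n; s≤s; z<s)
open import Data.Nat.Properties
  using (≤-refl; ≤-trans; <-≤-trans; <⇒≤; n≤1+n; m≤n+m; +-monoʳ-≤; +-suc; +-comm;
         m<n⇒0<n∸m; m+n∸m≡n; m+[n∸m]≡n; m∸n+n≡m; m+n≤o⇒m≤o∸n)
open import Data.Nat.Divisibility using (divides)
open import Data.Nat.ListAction using (sum)
open import Data.Nat.Tactic.RingSolver using (solve-∀)
open import Data.List using ([]; _∷_; _++_)
open import Data.List.Properties using (++-identityʳ)
open import Data.List.Relation.Unary.All using (All; []; _∷_)
open import Data.List.Relation.Unary.All.Properties using (++⁺; replicate⁺)
open import Data.Product using (_×_; _,_; proj₁; proj₂; ∃-syntax)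
open import Data.Sum using (_⊎_; inj₁; inj₂)
open import Data.Empty using (⊥-elim)
open import Relation.Binary.PropositionalEquality
  using (_≡_; refl; sym; trans; cong; cong₂; subst; module ≡-Reasoning)
open ≡-Reasoning

-- The recursion satisfied by SG

AllPositive : Partition → Set
AllPositive = All (0 <_)

sum-L≤ : ∀ xs → sum (L xs) ≤ sum xs
sum-L≤ []                 = z≤n
sum-L≤ (zero ∷ xs)        = sum-L≤ xs
sum-L≤ (suc zero ∷ xs)    = ≤-trans (sum-L≤ xs) (n≤1+n _)
sum-L≤ (suc (suc x) ∷ xs) = s≤s (≤-trans (+-monoʳ-≤ x (sum-L≤ xs)) (n≤1+n _))

sum-L< : ∀ x xs → sum (L (suc x ∷ xs)) < sum (suc x ∷ xs)
sum-L< zero    xs = s≤s (sum-L≤ xs)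
sum-L< (suc x) xs = s≤s (s≤s (+-monoʳ-≤ x (sum-L≤ xs)))

sum-T< : ∀ x xs → sum xs < sum (suc x ∷ xs)
sum-T< x xs = s≤s (m≤n+m (sum xs) x)

L-positive : ∀ xs → AllPositive (L xs)
L-positive []                 = []
L-positive (zero ∷ xs)        = L-positive xs
L-positive (suc zero ∷ xs)    = L-positive xs
L-positive (suc (suc x) ∷ xs) = z<s ∷ L-positive xs

-- Every move strictly lowers the sum of the parts (this needs the parts to be
-- positive), so any fuel above it gives the same value.
sgFuel-irrelevant : ∀ {f g} xs → AllPositive xs → sum xs < f → sum xs < g →
                    sgFuel f xs ≡ sgFuel g xs
sgFuel-irrelevant []           _         _        _        = refl
sgFuel-irrelevant (zero ∷ _)   (() ∷ _)  _        _
sgFuel-irrelevant (suc x ∷ xs) (_ ∷ pos) (s≤s <f) (s≤s <g) =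
  cong₂ mex2
    (sgFuel-irrelevant (L (suc x ∷ xs)) (L-positive (suc x ∷ xs))
       (<-≤-trans (sum-L< x xs) <f) (<-≤-trans (sum-L< x xs) <g))
    (sgFuel-irrelevant xs pos (<-≤-trans (sum-T< x xs) <f) (<-≤-trans (sum-T< x xs) <g))

SG-step : ∀ x xs → AllPositive xs → SG (suc x ∷ xs) ≡ mex2 (SG (L (suc x ∷ xs))) (SG xs)
SG-step x xs pos =
  cong₂ mex2
    (sgFuel-irrelevant (L (suc x ∷ xs)) (L-positive (suc x ∷ xs)) (sum-L< x xs) ≤-refl)
    (sgFuel-irrelevant xs pos (sum-T< x xs) ≤-refl)

L-ones : ∀ p → L (1 ^^ p) ≡ []
L-ones zero    = refl
L-ones (suc p) = L-ones p

L-replicate : ∀ a p → L (suc (suc a) ^^ p) ≡ suc a ^^ p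
L-replicate a zero    = refl
L-replicate a (suc p) = cong (suc a ∷_) (L-replicate a p)

L-replicate-++ : ∀ a p ys → L (suc (suc a) ^^ p ++ ys) ≡ suc a ^^ p ++ L ys
L-replicate-++ a zero    ys = refl
L-replicate-++ a (suc p) ys = cong (suc a ∷_) (L-replicate-++ a p ys)

twoBlock : ℕ → ℕ → ℕ → ℕ → Partition
twoBlock n m r s = n ^^ m ++ r ^^ s

twoBlock-positive : ∀ n m r s → AllPositive (twoBlock (suc n) m (suc r) s)
twoBlock-positive n m r s = ++⁺ (replicate⁺ m z<s) (replicate⁺ s z<s)

SG-ones-step : ∀ p → SG (1 ^^ suc p) ≡ mex2 0 (SG (1 ^^ p))
SG-ones-step p =
  trans (SG-step 0 (1 ^^ p) (replicate⁺ p z<s)) (cong₂ mex2 (cong SG (L-ones p)) refl)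

SG-replicate-step : ∀ a p →
  SG (suc (suc a) ^^ suc p) ≡ mex2 (SG (suc a ^^ suc p)) (SG (suc (suc a) ^^ p))
SG-replicate-step a p =
  trans (SG-step (suc a) _ (replicate⁺ p z<s)) (cong₂ mex2 (cong SG (L-replicate a (suc p))) refl)

SG-twoBlock-ones-step : ∀ d p s →
  SG (twoBlock (suc (suc d)) (suc p) 1 s)
    ≡ mex2 (SG (suc d ^^ suc p)) (SG (twoBlock (suc (suc d)) p 1 s))
SG-twoBlock-ones-step d p s =
  trans (SG-step (suc d) _ (twoBlock-positive (suc d) p 0 s)) (cong₂ mex2 (cong SG L-twoBlock) refl)
  where
  L-twoBlock : L (twoBlock (suc (suc d)) (suc p) 1 s) ≡ suc d ^^ suc p
  L-twoBlock = begin
    L (suc (suc d) ^^ suc p ++ 1 ^^ s)  ≡⟨ L-replicate-++ d (suc p) (1 ^^ s) ⟩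
    suc d ^^ suc p ++ L (1 ^^ s)        ≡⟨ cong (suc d ^^ suc p ++_) (L-ones s) ⟩
    suc d ^^ suc p ++ []                ≡⟨ ++-identityʳ _ ⟩
    suc d ^^ suc p                      ∎

SG-twoBlock-step : ∀ n r p s →
  SG (twoBlock (suc (suc n)) (suc p) (suc (suc r)) s)
    ≡ mex2 (SG (twoBlock (suc n) (suc p) (suc r) s)) (SG (twoBlock (suc (suc n)) p (suc (suc r)) s))
SG-twoBlock-step n r p s =
  trans (SG-step (suc n) _ (twoBlock-positive (suc n) p (suc r) s))
        (cong₂ mex2 (cong SG L-twoBlock) refl)
  where
  L-twoBlock : L (twoBlock (suc (suc n)) (suc p) (suc (suc r)) s) ≡ twoBlock (suc n) (suc p) (suc r) s
  L-twoBlock = trans (L-replicate-++ n (suc p) _) (cong (suc n ^^ suc p ++_) (L-replicate r s))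

-- Eventually alternating sequences

alternate : ℕ → ℕ → ℕ → ℕ
alternate a b zero    = a
alternate a b (suc k) = alternate b a k

infixr 5 _∷ˢ_
_∷ˢ_ : ℕ → (ℕ → ℕ) → ℕ → ℕ
(x ∷ˢ f) zero    = x
(x ∷ˢ f) (suc k) = f k

mex2-alternate : ∀ a b c d k →
  mex2 (alternate a b k) (alternate c d k) ≡ alternate (mex2 a c) (mex2 b d) k
mex2-alternate a b c d zero    = refl
mex2-alternate a b c d (suc k) = mex2-alternate b a d c k

alternate-same : ∀ a k → alternate a a k ≡ a
alternate-same a zero    = refl
alternate-same a (suc k) = alternate-same a k

∷ˢ-alternate : ∀ a b k → (a ∷ˢ b ∷ˢ alternate a b) k ≡ alternate a b k
∷ˢ-alternate a b zero          = refl
∷ˢ-alternate a b (suc zero)    = refl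
∷ˢ-alternate a b (suc (suc k)) = refl

∷ˢ-alternate-shift : ∀ x y z w k →
  (x ∷ˢ y ∷ˢ alternate z w) (suc k) ≡ (y ∷ˢ z ∷ˢ alternate w z) k
∷ˢ-alternate-shift x y z w zero          = refl
∷ˢ-alternate-shift x y z w (suc zero)    = refl
∷ˢ-alternate-shift x y z w (suc (suc k)) = refl

alternate-*2 : ∀ a b k → alternate a b (k * 2) ≡ a
alternate-*2 a b zero    = refl
alternate-*2 a b (suc k) = alternate-*2 a b k

alternate-*2+ : ∀ a b t k → alternate a b (t * 2 + k) ≡ alternate a b k
alternate-*2+ a b zero    k = refl
alternate-*2+ a b (suc t) k = alternate-*2+ a b t k

≡*2⊎≡1+*2 : ∀ n → ∃[ k ] (n ≡ k * 2 ⊎ n ≡ suc (k * 2))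
≡*2⊎≡1+*2 zero = 0 , inj₁ refl
≡*2⊎≡1+*2 (suc n) with ≡*2⊎≡1+*2 n
... | k , inj₁ refl = k , inj₂ refl
... | k , inj₂ refl = suc k , inj₁ refl

alternate-even : ∀ a b {k} → Even k → alternate a b k ≡ a
alternate-even a b (divides q refl) = alternate-*2 a b q

alternate-odd : ∀ a b {k} → Odd k → alternate a b k ≡ b
alternate-odd a b {k} odd with ≡*2⊎≡1+*2 k
... | q , inj₁ k≡q*2 = ⊥-elim (odd (divides q k≡q*2))
... | q , inj₂ refl  = alternate-*2 b a q

mex2-suc-mex2-zero : ∀ a t → mex2 (suc a) (mex2 0 t) ≡ 0
mex2-suc-mex2-zero zero    zero          = refl
mex2-suc-mex2-zero zero    (suc zero)    = refl
mex2-suc-mex2-zero zero    (suc (suc _)) = refl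
mex2-suc-mex2-zero (suc _) zero          = refl
mex2-suc-mex2-zero (suc _) (suc zero)    = refl
mex2-suc-mex2-zero (suc _) (suc (suc _)) = refl

mex2-zero-mex2-one : ∀ t → mex2 0 (mex2 1 t) ≡ 1
mex2-zero-mex2-one zero          = refl
mex2-zero-mex2-one (suc zero)    = refl
mex2-zero-mex2-one (suc (suc _)) = refl

-- The last hypothesis says that one period closes up; the recursion then repeats it.
column : (f g : ℕ → ℕ) {x y z w x′ : ℕ} →
  (∀ k → f (suc k) ≡ mex2 (g k) (f k)) →
  (∀ k → g k ≡ (x ∷ˢ y ∷ˢ alternate z w) k) →
  f 1 ≡ x′ →
  let y′ = mex2 y x′
      z′ = mex2 z y′
      w′ = mex2 w z′
  in mex2 z w′ ≡ z′ → ∀ k → f (suc k) ≡ (x′ ∷ˢ y′ ∷ˢ alternate z′ w′) k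
column f g {x} {y} {z} {w} {x′} rec g≡ f₁ closed = f∘suc≡
  where
  y′ z′ w′ : ℕ
  y′ = mex2 y x′
  z′ = mex2 z y′
  w′ = mex2 w z′

  f₂ : f 2 ≡ y′
  f₂ = trans (rec 1) (cong₂ mex2 (g≡ 1) f₁)

  f₃₊ : ∀ k → f (3 + k) ≡ alternate z′ w′ k
  f₃₊ zero    = trans (rec 2) (cong₂ mex2 (g≡ 2) f₂)
  f₃₊ (suc k) = begin
    f (4 + k)                                   ≡⟨ rec (3 + k) ⟩
    mex2 (g (3 + k)) (f (3 + k))                ≡⟨ cong₂ mex2 (g≡ (3 + k)) (f₃₊ k) ⟩
    mex2 (alternate w z k) (alternate z′ w′ k)  ≡⟨ mex2-alternate w z z′ w′ k ⟩
    alternate w′ (mex2 z w′) k                  ≡⟨ cong (λ t → alternate w′ t k) closed ⟩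
    alternate w′ z′ k                           ∎

  f∘suc≡ : ∀ k → f (suc k) ≡ (x′ ∷ˢ y′ ∷ˢ alternate z′ w′) k
  f∘suc≡ zero          = f₁
  f∘suc≡ (suc zero)    = f₂
  f∘suc≡ (suc (suc k)) = f₃₊ k

-- Rectangles

SG-ones : ∀ p → SG (1 ^^ suc p) ≡ (1 ∷ˢ 2 ∷ˢ alternate 1 2) p
SG-ones = column (λ p → SG (1 ^^ p)) (λ _ → 0) SG-ones-step zero≡ refl refl
  where
  zero≡ : ∀ k → 0 ≡ (0 ∷ˢ 0 ∷ˢ alternate 0 0) k
  zero≡ k = sym (trans (∷ˢ-alternate 0 0 k) (alternate-same 0 k))

SG-replicate-column : ∀ a {x y z w} →
  (∀ p → SG (suc a ^^ suc p) ≡ (x ∷ˢ y ∷ˢ alternate z w) p) →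
  let x′ = mex2 x 0
      y′ = mex2 y x′
      z′ = mex2 z y′
      w′ = mex2 w z′
  in mex2 z w′ ≡ z′ → ∀ p → SG (suc (suc a) ^^ suc p) ≡ (x′ ∷ˢ y′ ∷ˢ alternate z′ w′) p
SG-replicate-column a rect =
  column (λ p → SG (suc (suc a) ^^ p)) (λ p → SG (suc a ^^ suc p)) (SG-replicate-step a) rect
         (trans (SG-replicate-step a 0) (cong₂ mex2 (rect 0) refl))

SG-twos : ∀ p → SG (2 ^^ suc p) ≡ (2 ∷ˢ 0 ∷ˢ alternate 2 0) p
SG-twos = SG-replicate-column 0 SG-ones refl

SG-odd-replicate  : ∀ k p → SG ((3 + k * 2) ^^ suc p) ≡ (1 ∷ˢ 2 ∷ˢ alternate 0 1) p
SG-even-replicate : ∀ k p → SG ((4 + k * 2) ^^ suc p) ≡ (2 ∷ˢ 0 ∷ˢ alternate 1 0) p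

SG-odd-replicate zero    = SG-replicate-column 1 SG-twos refl
SG-odd-replicate (suc k) = SG-replicate-column (3 + k * 2) (SG-even-replicate k) refl

SG-even-replicate k = SG-replicate-column (2 + k * 2) (SG-odd-replicate k) refl

-- Two-block partitions

-- Coordinates relative to r = b + 1: c = n − r and k = m − r.
H : ℕ → ℕ → ℕ → ℕ → ℕ
H c b k s = SG (twoBlock (suc b + c) (k + suc b) (suc b) s)

H-step : ∀ c b k s → H c (suc b) (suc k) s ≡ mex2 (H c b (suc (suc k)) s) (H c (suc b) k s)
H-step c b k s =
  trans (SG-twoBlock-step (b + c) b (k + suc (suc b)) s)
        (cong (λ m → mex2 (SG (twoBlock (suc b + c) (suc m) (suc b) s)) (H c (suc b) k s))
              (+-suc k (suc b)))

H-corner : ∀ c b s → ∃[ z ] H c (suc b) 0 s ≡ mex2 (H c b 1 s) (mex2 (H c b 0 s) z)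
H-corner c b s =
  _ , trans (SG-twoBlock-step (b + c) b (suc b) s)
            (cong (mex2 (H c b 1 s)) (SG-twoBlock-step (b + c) b b s))

H-first-step : ∀ d k s → H (suc d) 0 (suc k) s ≡ mex2 (SG (suc d ^^ suc (suc k))) (H (suc d) 0 k s)
H-first-step d k s =
  trans (SG-twoBlock-ones-step d (k + 1) s)
        (cong (λ m → mex2 (SG (suc d ^^ suc m)) (H (suc d) 0 k s)) (+-comm k 1))

H-first-column : ∀ d q {x y z w} →
  (∀ p → SG (suc d ^^ suc p) ≡ (suc x ∷ˢ y ∷ˢ alternate z w) p) →
  let x′ = mex2 y 0
      y′ = mex2 z x′
      z′ = mex2 w y′
      w′ = mex2 z z′
  in mex2 w w′ ≡ z′ → ∀ k → H (suc d) 0 k (suc q) ≡ (0 ∷ˢ x′ ∷ˢ y′ ∷ˢ alternate z′ w′) k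
H-first-column d q {x} rect closed zero = corner
  where
  corner : H (suc d) 0 0 (suc q) ≡ 0
  corner = trans (SG-twoBlock-ones-step d 0 (suc q))
                 (trans (cong₂ mex2 (rect 0) (SG-ones-step q)) (mex2-suc-mex2-zero x _))
H-first-column d q {x} {y} {z} {w} rect closed (suc k) =
  column (λ k → H (suc d) 0 k (suc q)) (λ k → SG (suc d ^^ suc (suc k)))
         (λ k → H-first-step d k (suc q))
         (λ k → trans (rect (suc k)) (∷ˢ-alternate-shift (suc x) y z w k))
         (trans (H-first-step d 0 (suc q)) (cong₂ mex2 (rect 1) (H-first-column d q rect closed 0)))
         closed k

ParityCase : ℕ → Set
ParityCase c = c ≡ 1 ⊎ c ≡ 2 ⊎ ∃[ k ] c ≡ 4 + k * 2

H-parityCase-first : ∀ c → ParityCase c → ∀ q k →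
  H c 0 (suc k) (suc q) ≡ (1 ∷ˢ 0 ∷ˢ alternate 1 0) k
H-parityCase-first .1 (inj₁ refl)                 q k = H-first-column 0 q SG-ones refl (suc k)
H-parityCase-first .2 (inj₂ (inj₁ refl))          q k = H-first-column 1 q SG-twos refl (suc k)
H-parityCase-first _  (inj₂ (inj₂ (j , refl)))    q k =
  H-first-column (3 + j * 2) q (SG-even-replicate j) refl (suc k)

H-parityCase-next : ∀ c b s → (∀ k → H c b (suc k) s ≡ (1 ∷ˢ 0 ∷ˢ alternate 1 0) k) →
  ∀ k → H c (suc b) (suc k) s ≡ (1 ∷ˢ 0 ∷ˢ alternate 1 0) k
H-parityCase-next c b s prev =
  column (λ k → H c (suc b) k s) (λ k → H c b (suc (suc k)) s) (λ k → H-step c b k s)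
         (λ k → trans (prev (suc k)) (∷ˢ-alternate-shift 1 0 1 0 k)) f₁ refl
  where
  z : ℕ
  z = proj₁ (H-corner c b s)

  f₁ : H c (suc b) 1 s ≡ 1
  f₁ = begin
    H c (suc b) 1 s                             ≡⟨ H-step c b 0 s ⟩
    mex2 (H c b 2 s) (H c (suc b) 0 s)          ≡⟨ cong₂ mex2 (prev 1) (proj₂ (H-corner c b s)) ⟩
    mex2 0 (mex2 (H c b 1 s) (mex2 (H c b 0 s) z))
      ≡⟨ cong (λ t → mex2 0 (mex2 t (mex2 (H c b 0 s) z))) (prev 0) ⟩
    mex2 0 (mex2 1 (mex2 (H c b 0 s) z))        ≡⟨ mex2-zero-mex2-one _ ⟩
    1                                           ∎

H-parityCase : ∀ c → ParityCase c → ∀ b q {e} → 0 < e → H c b e (suc q) ≡ alternate 0 1 e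
H-parityCase c shape b q {suc k} _ = trans (column-b b k) (∷ˢ-alternate 1 0 k)
  where
  column-b : ∀ b k → H c b (suc k) (suc q) ≡ (1 ∷ˢ 0 ∷ˢ alternate 1 0) k
  column-b zero    = H-parityCase-first c shape q
  column-b (suc b) = H-parityCase-next c b (suc q) (column-b b)

H-oddCase-next : ∀ c b s → (∀ k → H c b k s ≡ (0 ∷ˢ 1 ∷ˢ 2 ∷ˢ alternate 0 1) k) →
  ∀ k → H c (suc b) k s ≡ (0 ∷ˢ 1 ∷ˢ 2 ∷ˢ alternate 0 1) k
H-oddCase-next c b s prev zero    = f₀
  where
  z : ℕ
  z = proj₁ (H-corner c b s)

  f₀ : H c (suc b) 0 s ≡ 0
  f₀ = begin
    H c (suc b) 0 s                        ≡⟨ proj₂ (H-corner c b s) ⟩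
    mex2 (H c b 1 s) (mex2 (H c b 0 s) z)  ≡⟨ cong₂ (λ u v → mex2 u (mex2 v z)) (prev 1) (prev 0) ⟩
    mex2 1 (mex2 0 z)                      ≡⟨ mex2-suc-mex2-zero 0 z ⟩
    0                                      ∎
H-oddCase-next c b s prev (suc k) =
  column (λ k → H c (suc b) k s) (λ k → H c b (suc (suc k)) s) (λ k → H-step c b k s)
         (λ k → trans (prev (2 + k)) (∷ˢ-alternate-shift 1 2 0 1 k))
         (trans (H-step c b 0 s) (cong₂ mex2 (prev 2) (H-oddCase-next c b s prev 0)))
         refl k

H-oddCase : ∀ j b q k → H (3 + j * 2) b k (suc q) ≡ (0 ∷ˢ 1 ∷ˢ 2 ∷ˢ alternate 0 1) k
H-oddCase j zero    q = H-first-column (2 + j * 2) q (SG-odd-replicate j) refl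
H-oddCase j (suc b) q = H-oddCase-next (3 + j * 2) b (suc q) (H-oddCase j b q)

+2<⇒2<∸ : ∀ {n r} → n > r + 2 → 2 < n ∸ r
+2<⇒2<∸ {n} {r} n>r+2 = m+n≤o⇒m≤o∸n 3 (subst (_≤ n) (+-comm (suc r) 2) n>r+2)

even>2⇒≡4+*2 : ∀ {c} → Even c → 2 < c → ∃[ k ] c ≡ 4 + k * 2
even>2⇒≡4+*2 (divides zero          refl) ()
even>2⇒≡4+*2 (divides (suc zero)    refl) (s≤s (s≤s ()))
even>2⇒≡4+*2 (divides (suc (suc k)) refl) _ = k , refl

odd>2⇒≡3+*2 : ∀ {c} → Odd c → 2 < c → ∃[ k ] c ≡ 3 + k * 2
odd>2⇒≡3+*2 {c} odd c>2 with ≡*2⊎≡1+*2 c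
odd>2⇒≡3+*2 odd _                 | k     , inj₁ c≡k*2 = ⊥-elim (odd (divides k c≡k*2))
odd>2⇒≡3+*2 _   (s≤s ())          | zero  , inj₂ refl
odd>2⇒≡3+*2 _   _                 | suc k , inj₂ refl  = k , refl

parityCase : ∀ {n r} → (n ≡ r + 1 ⊎ n ≡ r + 2 ⊎ (n > r + 2 × Even (n ∸ r))) → ParityCase (n ∸ r)
parityCase {r = r} (inj₁ refl)          = inj₁ (m+n∸m≡n r 1)
parityCase {r = r} (inj₂ (inj₁ refl))   = inj₂ (inj₁ (m+n∸m≡n r 2))
parityCase (inj₂ (inj₂ (n>r+2 , even))) = inj₂ (inj₂ (even>2⇒≡4+*2 even (+2<⇒2<∸ n>r+2)))

oddCase-tail : ∀ {e} → 3 ≤ e → (0 ∷ˢ 1 ∷ˢ 2 ∷ˢ alternate 0 1) e ≡ alternate 1 0 e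
oddCase-tail (s≤s (s≤s (s≤s _))) = refl

SG-twoBlock≡H : ∀ n m b s → suc b ≤ n → suc b ≤ m →
  SG (twoBlock n m (suc b) s) ≡ H (n ∸ suc b) b (m ∸ suc b) s
SG-twoBlock≡H n m b s r≤n r≤m =
  cong₂ (λ n′ m′ → SG (twoBlock n′ m′ (suc b) s)) (sym (m+[n∸m]≡n r≤n)) (sym (m∸n+n≡m r≤m))

*2+∸≡+ : ∀ {r m} → r ≤ m → r * 2 + (m ∸ r) ≡ r + m
*2+∸≡+ {r} {m} r≤m = trans (*2+≡++ r (m ∸ r)) (cong (r +_) (m+[n∸m]≡n r≤m))
  where
  *2+≡++ : ∀ r e → r * 2 + e ≡ r + (r + e)
  *2+≡++ = solve-∀

SG-parityCase : ∀ n m b q → suc b < m → suc b ≤ n → ParityCase (n ∸ suc b) →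
  SG (twoBlock n m (suc b) (suc q)) ≡ alternate 0 1 (suc b + m)
SG-parityCase n m b q r<m r≤n shape = begin
  SG (twoBlock n m (suc b) (suc q))        ≡⟨ SG-twoBlock≡H n m b (suc q) r≤n (<⇒≤ r<m) ⟩
  H (n ∸ suc b) b (m ∸ suc b) (suc q)      ≡⟨ H-parityCase (n ∸ suc b) shape b q (m<n⇒0<n∸m r<m) ⟩
  alternate 0 1 (m ∸ suc b)                ≡⟨ sym (alternate-*2+ 0 1 (suc b) (m ∸ suc b)) ⟩
  alternate 0 1 (suc b * 2 + (m ∸ suc b))  ≡⟨ cong (alternate 0 1) (*2+∸≡+ (<⇒≤ r<m)) ⟩
  alternate 0 1 (suc b + m)                ∎

SG-oddCase : ∀ n m b q → suc b ≤ m → suc b ≤ n → ∃[ j ] n ∸ suc b ≡ 3 + j * 2 →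
  SG (twoBlock n m (suc b) (suc q)) ≡ (0 ∷ˢ 1 ∷ˢ 2 ∷ˢ alternate 0 1) (m ∸ suc b)
SG-oddCase n m b q r≤m r≤n (j , c≡) = begin
  SG (twoBlock n m (suc b) (suc q))        ≡⟨ SG-twoBlock≡H n m b (suc q) r≤n r≤m ⟩
  H (n ∸ suc b) b (m ∸ suc b) (suc q)      ≡⟨ cong (λ c → H c b (m ∸ suc b) (suc q)) c≡ ⟩
  H (3 + j * 2) b (m ∸ suc b) (suc q)      ≡⟨ H-oddCase j b q (m ∸ suc b) ⟩
  (0 ∷ˢ 1 ∷ˢ 2 ∷ˢ alternate 0 1) (m ∸ suc b) ∎

theorem3p16 : (n m r s : ℕ) → 0 < n → 0 < m → 0 < r → 0 < s → m > r → n > r →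
    let λ′ = (n ^^ m) ++ (r ^^ s) in
    ((n ≡ r + 1 ⊎ n ≡ r + 2 ⊎ (n > r + 2 × Even (n ∸ r))) →
    (Even (r + m) → SG λ′ ≡ 0) × (Odd (r + m) → SG λ′ ≡ 1))
    ×
    ((n > r + 2 × Odd (n ∸ r)) →
    ((Odd (m ∸ r) × m ∸ r ≥ 3) → SG λ′ ≡ 0)
    × ((m ∸ r ≡ 1 ⊎ (Even (m ∸ r) × m ∸ r ≥ 4)) → SG λ′ ≡ 1)
    × (m ∸ r ≡ 2 → SG λ′ ≡ 2))
theorem3p16 n m zero    s       _ _ () _  _   _
theorem3p16 n m (suc b) zero    _ _ _  () _   _
theorem3p16 n m (suc b) (suc q) _ _ _  _  r<m r<n =
  (λ shape →
     let value = SG-parityCase n m b q r<m (<⇒≤ r<n) (parityCase {r = suc b} shape) in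
     (λ even → trans value (alternate-even 0 1 even)) , (λ odd → trans value (alternate-odd 0 1 odd)))
  , λ (n>r+2 , odd) →
      let value = SG-oddCase n m b q (<⇒≤ r<m) (<⇒≤ r<n) (odd>2⇒≡3+*2 odd (+2<⇒2<∸ {r = suc b} n>r+2)) in
      (λ (odd-e , e≥3) → trans value (trans (oddCase-tail e≥3) (alternate-odd 1 0 odd-e)))
      , (λ { (inj₁ e≡1)            → trans value (cong (0 ∷ˢ 1 ∷ˢ 2 ∷ˢ alternate 0 1) e≡1)
           ; (inj₂ (even-e , e≥4)) →
               trans value (trans (oddCase-tail (<⇒≤ e≥4)) (alternate-even 1 0 even-e)) })
      , (λ e≡2 → trans value (cong (0 ∷ˢ 1 ∷ˢ 2 ∷ˢ alternate 0 1) e≡2))
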